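{- For any graph $G$ and any distension $\widehat{G}$ of $G$, $\operatorname{tw}(\widehat{G})\leq\max\{\operatorname{tw}(G),3\}$ and $\operatorname{pw}(\widehat{G})\leq\operatorname{pw}(G)+2$.
   Context: All graphs are finite, simple and undirected. $\operatorname{tw}$ and $\operatorname{pw}$ denote treewidth and pathwidth. A distension of a graph $G$ is any graph $\widehat{G}$ obtained from $G$ by adding, for each edge $vw$ of $G$, a new path $P_{vw}$ (vertex-disjoint from $G$ and from the paths $P_{ab}$ for all other edges $ab$) in which every vertex is made adjacent to both $v$ and $w$. -}

module Defs where

open import Data.Nat using (ℕ; zero; suc; _≤_; _<ᵇ_)
open import Data.Fin using (Fin; toℕ; fromℕ) renaming (zero to fzero)
open import Data.Bool using (Bool; true; false; T; _∧_)
open import Data.List using (List; length)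
open import Data.List.Membership.Propositional using (_∈_)
open import Data.Product using (Σ; ∃; _×_; _,_; proj₁; proj₂)
open import Data.Sum using (_⊎_; inj₁; inj₂)
open import Data.Unit using (⊤)
open import Data.Empty using (⊥)
open import Relation.Nullary using (¬_)
open import Relation.Binary.PropositionalEquality using (_≡_)
open import Function.Definitions using (Injective)

record FinGraph (n : ℕ) : Set where
  field
    adj        : Fin n → Fin n → Bool
    adj-sym    : ∀ u v → adj u v ≡ adj v u
    adj-irrefl : ∀ v → adj v v ≡ false

  Adj : Fin n → Fin n → Set
  Adj u v = T (adj u v)

open FinGraph public

data WalkIn {A : Set} (R : A → A → Set) (P : A → Set) : A → A → Set where
  stop : ∀ {x} → P x → WalkIn R P x x
  step : ∀ {x y z} → P x → R x y → WalkIn R P y z → WalkIn R P x z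

Everywhere : {A : Set} → A → Set
Everywhere _ = ⊤

HasCycle : (m : ℕ) → (Fin m → Fin m → Set) → Set
HasCycle m R =
  Σ ℕ λ k → Σ (Fin (suc (suc (suc k))) → Fin m) λ c →
    Injective _≡_ _≡_ c ×
    (∀ i j → suc (toℕ i) ≡ toℕ j → R (c i) (c j)) ×
    R (c (fromℕ (suc (suc k)))) (c fzero)

record IsTree (m : ℕ) (R : Fin m → Fin m → Set) : Set where
  field
    nonempty  : 1 ≤ m
    sym       : ∀ {x y} → R x y → R y x
    irrefl    : ∀ {x} → ¬ R x x
    connected : ∀ x y → WalkIn R Everywhere x y
    acyclic   : ¬ HasCycle m R

-- Tree decompositions of width ≤ k of a graph with vertex type V and
-- adjacency E.  Bags are lists; a bag of length ≤ k+1 has ≤ k+1 vertices.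

record TreeDecomp {V : Set} (E : V → V → Set) (k : ℕ) : Set₁ where
  field
    m        : ℕ
    tree     : Fin m → Fin m → Set
    isTree   : IsTree m tree
    bag      : Fin m → List V
    width    : ∀ t → length (bag t) ≤ suc k
    cover-v  : ∀ v → ∃ λ t → v ∈ bag t
    cover-e  : ∀ u v → E u v → ∃ λ t → (u ∈ bag t) × (v ∈ bag t)
    subtree  : ∀ v t t' → v ∈ bag t → v ∈ bag t' →
               WalkIn tree (λ s → v ∈ bag s) t t'

-- "tw(G) ≤ k" is: TreeDecomp E k is inhabited.

record PathDecomp {V : Set} (E : V → V → Set) (k : ℕ) : Set where
  field
    m        : ℕ
    bag      : Fin m → List V
    width    : ∀ t → length (bag t) ≤ suc k
    cover-v  : ∀ v → ∃ λ t → v ∈ bag t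
    cover-e  : ∀ u v → E u v → ∃ λ t → (u ∈ bag t) × (v ∈ bag t)
    interval : ∀ v (i j l : Fin m) → toℕ i ≤ toℕ j → toℕ j ≤ toℕ l →
               v ∈ bag i → v ∈ bag l → v ∈ bag j

Edge : ∀ {n} → FinGraph n → Set
Edge {n} G = Σ (Fin n) λ u → Σ (Fin n) λ v → T (adj G u v ∧ (toℕ u <ᵇ toℕ v))

-- A distension is determined (up to isomorphism) by the number of
-- vertices of each path P_e; path P_e has suc (len e) vertices
-- (a path has at least one vertex).  Vertices of the distension:
DistVertex : ∀ {n} (G : FinGraph n) → (Edge G → ℕ) → Set
DistVertex {n} G len = Fin n ⊎ Σ (Edge G) (λ e → Fin (suc (len e)))

data DistAdj₀ {n} (G : FinGraph n) (len : Edge G → ℕ) :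
              DistVertex G len → DistVertex G len → Set where
  old   : ∀ {u v} → Adj G u v → DistAdj₀ G len (inj₁ u) (inj₁ v)
  endˡ  : ∀ e i → DistAdj₀ G len (inj₁ (proj₁ e)) (inj₂ (e , i))
  endʳ  : ∀ e i → DistAdj₀ G len (inj₁ (proj₁ (proj₂ e))) (inj₂ (e , i))
  along : ∀ e (i j : Fin (suc (len e))) → toℕ j ≡ suc (toℕ i) →
          DistAdj₀ G len (inj₂ (e , i)) (inj₂ (e , j))

DistAdj : ∀ {n} (G : FinGraph n) (len : Edge G → ℕ) →
          DistVertex G len → DistVertex G len → Set
DistAdj G len x y = DistAdj₀ G len x y ⊎ DistAdj₀ G len y x

-- Fix a tree decomposition of G of width k and, for every edge vw, a bag t containing v and w.
-- Below t hang a path of new bags {v, w, p_i, p_(i-1)}, where p_0 … p_l is the path P_vw: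
-- these bags have at most 4 vertices, each p_i lies in two adjacent bags, and v and w still
-- occupy subtrees, so the width becomes max(k, 3). For a path decomposition, follow bag t
-- instead by the copies t ∪ {p_i, p_(i-1)}, i = 0 … l: the width grows by 2, each p_i again
-- lies in consecutive bags, and the intervals of the old vertices are merely stretched.
module Submission where

open import Defs
open import Data.Nat using (ℕ; zero; suc; _⊔_; _+_; _*_; _≤_; _<_; _<?_; _<ᵇ_; z≤n; s≤s)
import Data.Nat.Properties as ℕ
open import Data.Fin using (Fin; toℕ; fromℕ; fromℕ<; inject₁; inject≤; combine)
  renaming (zero to fzero; suc to fsuc)
import Data.Fin.Properties as Fin
open import Data.Bool using (T; _∧_)
open import Data.Bool.Properties using (T-∧; T-irrelevant)
open import Data.Maybe using (Maybe; just; nothing; maybe′)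
open import Data.Empty using (⊥; ⊥-elim)
open import Data.Unit using (⊤; tt)
open import Data.Product using (Σ; ∃; ∃₂; _×_; _,_; proj₁; proj₂; uncurry)
open import Data.Product.Algebra using (×-cong)
open import Data.Sum using (_⊎_; inj₁; inj₂)
open import Data.Sum.Algebra using (⊎-cong)
open import Data.List using (List; []; _∷_; length; map; _++_; allFin; cartesianProduct)
open import Data.List.Properties using (length-map; length-++)
open import Data.List.Membership.Propositional using (_∈_)
open import Data.List.Membership.Propositional.Properties
  using (∈-map⁻; ∈-map⁺; ∈-++⁺ˡ; ∈-++⁺ʳ; ∈-++⁻; ∈-allFin; ∈-cartesianProduct⁺)
open import Data.List.Relation.Unary.Any using (here; there)
import Data.List.Relation.Unary.All as All
open import Data.List.Extrema ℕ.≤-totalOrder using (argmax; f[xs]≤f[argmax]; max; xs≤max)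
open import Function using (_∘_; _on_; id)
open import Function.Bundles using (_↔_; Inverse; Equivalence)
open import Function.Definitions using (Injective)
open import Function.Properties.Inverse using (↔-refl; ↔-trans)
open import Relation.Nullary using (¬_; yes; no)
open import Relation.Nullary.Decidable using (T?)
open import Relation.Binary.PropositionalEquality
  using (_≡_; _≢_; refl; sym; trans; cong; subst; subst₂; module ≡-Reasoning)

module _ {A : Set} {R : A → A → Set} {P : A → Set} where

  sourceʷ : ∀ {x y} → WalkIn R P x y → P x
  sourceʷ (stop px) = px
  sourceʷ (step px _ _) = px

  _++ʷ_ : ∀ {x y z} → WalkIn R P x y → WalkIn R P y z → WalkIn R P x z
  stop _ ++ʷ w′ = w′
  step px r w ++ʷ w′ = step px r (w ++ʷ w′)

  reverseʷ : (∀ {x y} → R x y → R y x) → ∀ {x y} → WalkIn R P x y → WalkIn R P y x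
  reverseʷ R-sym (stop px) = stop px
  reverseʷ R-sym (step px r w) = reverseʷ R-sym w ++ʷ step (sourceʷ w) (R-sym r) (stop px)

  trivialʷ : ∀ {x y} → x ≡ y → P x → WalkIn R P x y
  trivialʷ refl px = stop px

mapʷ : {A B : Set} {R : A → A → Set} {P : A → Set} {S : B → B → Set} {Q : B → Set}
       (f : A → B) → (∀ {x y} → R x y → S (f x) (f y)) → (∀ {x} → P x → Q (f x)) →
       ∀ {x y} → WalkIn R P x y → WalkIn S Q (f x) (f y)
mapʷ f f-R f-P (stop px) = stop (f-P px)
mapʷ f f-R f-P (step px r w) = step (f-P px) (f-R r) (mapʷ f f-R f-P w)

IsCycle : {A : Set} → (A → A → Set) → ∀ k → (Fin (suc (suc (suc k))) → A) → Set
IsCycle R k c =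
  Injective _≡_ _≡_ c ×
  (∀ i j → suc (toℕ i) ≡ toℕ j → R (c i) (c j)) ×
  R (c (fromℕ (suc (suc k)))) (c fzero)

-- For A = Fin m this unfolds to HasCycle m R.
Cycle : {A : Set} → (A → A → Set) → Set
Cycle {A} R = Σ ℕ λ k → Σ (Fin (suc (suc (suc k))) → A) (IsCycle R k)

record IsTreeOn (A : Set) (R : A → A → Set) : Set where
  field
    point       : A
    symmetric   : ∀ {x y} → R x y → R y x
    irreflexive : ∀ {x} → ¬ R x x
    connected   : ∀ x y → WalkIn R Everywhere x y
    acyclic     : ¬ Cycle R

IsTree⇒IsTreeOn : ∀ {m R} → IsTree m R → IsTreeOn (Fin m) R
IsTree⇒IsTreeOn t = record
  { point = fromℕ< (IsTree.nonempty t)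
  ; symmetric = IsTree.sym t ; irreflexive = IsTree.irrefl t
  ; connected = IsTree.connected t ; acyclic = IsTree.acyclic t }

maximum : ∀ {q} (f : Fin (suc q) → ℕ) → ∃ λ i → ∀ j → f j ≤ f i
maximum f = argmax f fzero (allFin _) , λ j → All.lookup (f[xs]≤f[argmax] {f = f} fzero (allFin _)) (∈-allFin j)

cycle-neighbours : {A : Set} {R : A → A → Set} → (∀ {x y} → R x y → R y x) →
  ∀ k (c : Fin (suc (suc (suc k))) → A) → IsCycle R k c →
  ∀ x → ∃₂ λ y y′ → y ≢ y′ × R (c x) (c y) × R (c x) (c y′)
cycle-neighbours R-sym k c (_ , consecutive , closing) fzero =
  fromℕ (suc (suc k)) , fsuc fzero ,
  (λ eq → ℕ.1+n≢0 (ℕ.suc-injective (trans (sym (Fin.toℕ-fromℕ (suc (suc k)))) (cong toℕ eq)))) ,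
  R-sym closing , consecutive fzero (fsuc fzero) refl
cycle-neighbours {R = R} R-sym k c (_ , consecutive , closing) (fsuc x) with suc (toℕ x) ℕ.≟ suc (suc k)
... | yes x-last =
  inject₁ x , fzero ,
  (λ eq → ℕ.1+n≢0 (trans (ℕ.suc-injective (trans (sym x-last) (cong suc (sym (Fin.toℕ-inject₁ x)))))
                          (cong toℕ eq))) ,
  R-sym (consecutive (inject₁ x) (fsuc x) (cong suc (Fin.toℕ-inject₁ x))) ,
  subst (λ z → R (c z) (c fzero)) (Fin.toℕ-injective (trans (Fin.toℕ-fromℕ (suc (suc k))) (sym x-last))) closing
... | no x-not-last =
  inject₁ x , fromℕ< next ,
  (λ eq → ℕ.<⇒≢ (ℕ.m<n+m (toℕ x) {2} (s≤s z≤n))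
                 (trans (sym (Fin.toℕ-inject₁ x)) (trans (cong toℕ eq) (Fin.toℕ-fromℕ< next)))) ,
  R-sym (consecutive (inject₁ x) (fsuc x) (cong suc (Fin.toℕ-inject₁ x))) ,
  consecutive (fsuc x) (fromℕ< next) (sym (Fin.toℕ-fromℕ< next))
  where
  next : suc (suc (toℕ x)) < suc (suc (suc k))
  next = s≤s (ℕ.≤∧≢⇒< (Fin.toℕ≤pred[n] (fsuc x)) x-not-last)

module Reindex {N : ℕ} {I : Set} (ι : Fin N ↔ I) where
  open Inverse ι

  to-injective : Injective _≡_ _≡_ to
  to-injective {u} {v} eq = trans (sym (strictlyInverseʳ u)) (trans (cong from eq) (strictlyInverseʳ v))

  from-injective : Injective _≡_ _≡_ from
  from-injective {x} {y} eq = trans (sym (strictlyInverseˡ x)) (trans (cong to eq) (strictlyInverseˡ y))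

  pullʷ : ∀ {R : I → I → Set} {Q : I → Set} {u v} →
          WalkIn R Q (to u) (to v) → WalkIn (R on to) (Q ∘ to) u v
  pullʷ {R} {Q} {u} {v} w =
    subst₂ (WalkIn (R on to) (Q ∘ to)) (strictlyInverseʳ u) (strictlyInverseʳ v)
      (mapʷ from (λ {x} {y} → subst₂ R (sym (strictlyInverseˡ x)) (sym (strictlyInverseˡ y)))
                 (λ {x} → subst Q (sym (strictlyInverseˡ x))) w)

  isTree-pullback : ∀ {R} → IsTreeOn I R → IsTree N (R on to)
  isTree-pullback t = record
    { nonempty = ℕ.≤-trans (s≤s z≤n) (Fin.toℕ<n (from point))
    ; sym = symmetric
    ; irrefl = irreflexive
    ; connected = λ u v → mapʷ id id _ (pullʷ (connected (to u) (to v)))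
    ; acyclic = λ (k , c , c-inj , consecutive , closing) →
        acyclic (k , to ∘ c , c-inj ∘ to-injective , consecutive , closing) }
    where open IsTreeOn t

  ∈-to∘from : ∀ {V : Set} (bag : I → List V) {v} x → v ∈ bag x → v ∈ bag (to (from x))
  ∈-to∘from bag {v} x = subst (λ y → v ∈ bag y) (sym (strictlyInverseˡ x))

covers-sym : ∀ {V I : Set} {R : V → V → Set} (bag : I → List V) →
  (∀ {u v} → R u v → ∃ λ t → (u ∈ bag t) × (v ∈ bag t)) →
  ∀ u v → R u v ⊎ R v u → ∃ λ t → (u ∈ bag t) × (v ∈ bag t)
covers-sym bag cover u v (inj₁ r) = cover r
covers-sym bag cover u v (inj₂ r) = let (t , v∈ , u∈) = cover r in t , u∈ , v∈

record TreeDecompOn {V : Set} (E : V → V → Set) (k : ℕ) (I : Set) : Set₁ where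
  field
    tree    : I → I → Set
    isTree  : IsTreeOn I tree
    bag     : I → List V
    width   : ∀ t → length (bag t) ≤ suc k
    cover-v : ∀ v → ∃ λ t → v ∈ bag t
    cover-e : ∀ u v → E u v → ∃ λ t → (u ∈ bag t) × (v ∈ bag t)
    subtree : ∀ v t t′ → v ∈ bag t → v ∈ bag t′ → WalkIn tree (λ s → v ∈ bag s) t t′

  toTreeDecomp : ∀ {N} → Fin N ↔ I → TreeDecomp E k
  toTreeDecomp ι = record
    { m = _
    ; tree = tree on to
    ; isTree = isTree-pullback isTree
    ; bag = bag ∘ to
    ; width = width ∘ to
    ; cover-v = λ v → let (t , v∈) = cover-v v in from t , ∈-to∘from bag t v∈
    ; cover-e = λ u v e → let (t , u∈ , v∈) = cover-e u v e
                          in from t , ∈-to∘from bag t u∈ , ∈-to∘from bag t v∈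
    ; subtree = λ v t t′ v∈ v∈′ → pullʷ (subtree v (to t) (to t′) v∈ v∈′) }
    where open Reindex ι; open Inverse ι

record PathDecompOn {V : Set} (E : V → V → Set) (k : ℕ) {N : ℕ} {I : Set} (ι : Fin N ↔ I) : Set where
  open Inverse ι
  field
    bag      : I → List V
    width    : ∀ t → length (bag t) ≤ suc k
    cover-v  : ∀ v → ∃ λ t → v ∈ bag t
    cover-e  : ∀ u v → E u v → ∃ λ t → (u ∈ bag t) × (v ∈ bag t)
    interval : ∀ v x y z → toℕ (from x) ≤ toℕ (from y) → toℕ (from y) ≤ toℕ (from z) →
               v ∈ bag x → v ∈ bag z → v ∈ bag y

  toPathDecomp : PathDecomp E k
  toPathDecomp = record
    { m = N
    ; bag = bag ∘ to
    ; width = width ∘ to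
    ; cover-v = λ v → let (t , v∈) = cover-v v in from t , ∈-to∘from bag t v∈
    ; cover-e = λ u v e → let (t , u∈ , v∈) = cover-e u v e
                          in from t , ∈-to∘from bag t u∈ , ∈-to∘from bag t v∈
    ; interval = λ v i j l i≤j j≤l v∈ v∈′ →
        interval v (to i) (to j) (to l) (subst₂ _≤_ (position i) (position j) i≤j)
                 (subst₂ _≤_ (position j) (position l) j≤l) v∈ v∈′ }
    where
    open Reindex ι
    position : ∀ i → toℕ i ≡ toℕ (from (to i))
    position i = cong toℕ (sym (strictlyInverseʳ i))

-- Node k of a pendant path carries the path vertices k and k − 1.
Covers : ℕ → ℕ → Set
Covers k j = k ≡ j ⊎ k ≡ suc j

covers-close : ∀ {a c j} → Covers a j → Covers c j → c ≤ suc a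
covers-close (inj₁ refl) (inj₁ refl) = ℕ.n≤1+n _
covers-close (inj₁ refl) (inj₂ refl) = ℕ.≤-refl
covers-close (inj₂ refl) (inj₁ refl) = ℕ.≤-trans (ℕ.n≤1+n _) (ℕ.n≤1+n _)
covers-close (inj₂ refl) (inj₂ refl) = ℕ.n≤1+n _

between-consecutive : ∀ {a b c} → a ≤ b → b ≤ c → c ≤ suc a → b ≡ a ⊎ b ≡ c
between-consecutive {a} {b} a≤b b≤c c≤1+a with b ℕ.≟ a
... | yes b≡a = inj₁ b≡a
... | no b≢a = inj₂ (ℕ.≤-antisym b≤c (ℕ.≤-trans c≤1+a (ℕ.≤∧≢⇒< a≤b (b≢a ∘ sym))))

atIndex : ∀ L → ℕ → List (Fin (suc L))
atIndex L k with k <? suc L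
... | yes k<L = fromℕ< k<L ∷ []
... | no _ = []

∈-atIndex⁺ : ∀ {L k} (j : Fin (suc L)) → k ≡ toℕ j → j ∈ atIndex L k
∈-atIndex⁺ {L} j refl with toℕ j <? suc L
... | yes j<L = here (sym (Fin.fromℕ<-toℕ j j<L))
... | no j≮L = ⊥-elim (j≮L (Fin.toℕ<n j))

∈-atIndex⁻ : ∀ {L k} {j : Fin (suc L)} → j ∈ atIndex L k → k ≡ toℕ j
∈-atIndex⁻ {L} {k} j∈ with k <? suc L
∈-atIndex⁻ (here refl) | yes k<L = sym (Fin.toℕ-fromℕ< k<L)

atIndex-length : ∀ L k → length (atIndex L k) ≤ 1
atIndex-length L k with k <? suc L
... | yes _ = s≤s z≤n
... | no _ = z≤n

window : ∀ L → ℕ → List (Fin (suc L))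
window L zero = atIndex L zero
window L (suc k) = atIndex L (suc k) ++ atIndex L k

∈-window⁺ : ∀ {L k} (j : Fin (suc L)) → Covers k (toℕ j) → j ∈ window L k
∈-window⁺ {k = zero} j (inj₁ eq) = ∈-atIndex⁺ j eq
∈-window⁺ {k = suc k} j (inj₁ eq) = ∈-++⁺ˡ (∈-atIndex⁺ j eq)
∈-window⁺ {k = suc k} j (inj₂ eq) = ∈-++⁺ʳ _ (∈-atIndex⁺ j (ℕ.suc-injective eq))

∈-window⁻ : ∀ {L k} {j : Fin (suc L)} → j ∈ window L k → Covers k (toℕ j)
∈-window⁻ {k = zero} j∈ = inj₁ (∈-atIndex⁻ j∈)
∈-window⁻ {L} {suc k} j∈ with ∈-++⁻ (atIndex L (suc k)) j∈
... | inj₁ j∈′ = inj₁ (∈-atIndex⁻ j∈′)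
... | inj₂ j∈′ = inj₂ (cong suc (∈-atIndex⁻ j∈′))

window-length : ∀ L k → length (window L k) ≤ 2
window-length L zero = ℕ.≤-trans (atIndex-length L zero) (s≤s z≤n)
window-length L (suc k) = ℕ.≤-trans (ℕ.≤-reflexive (length-++ (atIndex L (suc k))))
                                    (ℕ.+-mono-≤ (atIndex-length L (suc k)) (atIndex-length L k))

module Pendant {A P : Set} (T : A → A → Set) (root : P → A) (L : ℕ) where

  Node : Set
  Node = A ⊎ (P × Fin (suc L))

  data Link : Node → Node → Set where
    base : ∀ {s t} → T s t → Link (inj₁ s) (inj₁ t)
    hang : ∀ p → Link (inj₁ (root p)) (inj₂ (p , fzero))
    next : ∀ p (i j : Fin (suc L)) → suc (toℕ i) ≡ toℕ j → Link (inj₂ (p , i)) (inj₂ (p , j))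

  PendantTree : Node → Node → Set
  PendantTree x y = Link x y ⊎ Link y x

  pendant-sym : ∀ {x y} → PendantTree x y → PendantTree y x
  pendant-sym (inj₁ l) = inj₂ l
  pendant-sym (inj₂ l) = inj₁ l

  descend : (Q : Node → Set) → ∀ {p} → Q (inj₁ (root p)) → (∀ i → Q (inj₂ (p , i))) →
            ∀ i → WalkIn PendantTree Q (inj₂ (p , i)) (inj₁ (root p))
  descend Q {p} q-root q-chain i = go (toℕ i) i refl
    where
    go : ∀ n i → toℕ i ≡ n → WalkIn PendantTree Q (inj₂ (p , i)) (inj₁ (root p))
    go _ fzero _ = step (q-chain fzero) (inj₂ (hang p)) (stop q-root)
    go (suc n) (fsuc i) i≡n =
      step (q-chain (fsuc i)) (inj₂ (next p (inject₁ i) (fsuc i) (cong suc (Fin.toℕ-inject₁ i))))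
           (go n (inject₁ i) (trans (Fin.toℕ-inject₁ i) (ℕ.suc-injective i≡n)))

  coveringʷ : (Q : Node → Set) → ∀ {p} i i′ {j} → Covers (toℕ i) j → Covers (toℕ i′) j →
              Q (inj₂ (p , i)) → Q (inj₂ (p , i′)) → WalkIn PendantTree Q (inj₂ (p , i)) (inj₂ (p , i′))
  coveringʷ Q {p} i i′ (inj₁ eq) (inj₁ eq′) q q′ =
    trivialʷ (cong (λ i → inj₂ (p , i)) (Fin.toℕ-injective (trans eq (sym eq′)))) q
  coveringʷ Q {p} i i′ (inj₂ eq) (inj₂ eq′) q q′ =
    trivialʷ (cong (λ i → inj₂ (p , i)) (Fin.toℕ-injective (trans eq (sym eq′)))) q
  coveringʷ Q {p} i i′ (inj₁ eq) (inj₂ eq′) q q′ =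
    step q (inj₁ (next p i i′ (trans (cong suc eq) (sym eq′)))) (stop q′)
  coveringʷ Q {p} i i′ (inj₂ eq) (inj₁ eq′) q q′ =
    step q (inj₂ (next p i′ i (trans (cong suc eq′) (sym eq)))) (stop q′)

  rank : Node → ℕ
  rank (inj₁ _) = 0
  rank (inj₂ (_ , i)) = suc (toℕ i)

  parent : P → Fin (suc L) → Node
  parent p fzero = inj₁ (root p)
  parent p (fsuc i) = inj₂ (p , inject₁ i)

  lower-neighbour : ∀ {p i y} → PendantTree (inj₂ (p , i)) y → rank y ≤ suc (toℕ i) → y ≡ parent p i
  lower-neighbour (inj₁ (next _ _ _ eq)) y≤i = ⊥-elim (ℕ.<⇒≢ y≤i (sym eq))
  lower-neighbour (inj₂ (hang _)) _ = refl
  lower-neighbour {i = fsuc i} (inj₂ (next p j _ eq)) _ =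
    cong (λ j → inj₂ (p , j)) (Fin.toℕ-injective (trans (ℕ.suc-injective eq) (sym (Fin.toℕ-inject₁ i))))

  module _ (tree : IsTreeOn A T) where
    open IsTreeOn tree

    base-cycle : ∀ k (c : Fin (suc (suc (suc k))) → Node) (d : Fin (suc (suc (suc k))) → A) →
      (∀ j → c j ≡ inj₁ (d j)) → IsCycle PendantTree k c → IsCycle T k d
    base-cycle k c d c≡d (c-inj , consecutive , closing) =
      (λ {i} {j} eq → c-inj (trans (c≡d i) (trans (cong inj₁ eq) (sym (c≡d j))))) ,
      (λ i j i→j → inBase (subst₂ PendantTree (c≡d i) (c≡d j) (consecutive i j i→j))) ,
      inBase (subst₂ PendantTree (c≡d _) (c≡d fzero) closing)
      where
      inBase : ∀ {s t} → PendantTree (inj₁ s) (inj₁ t) → T s t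
      inBase (inj₁ (base r)) = r
      inBase (inj₂ (base r)) = symmetric r

    base-only-cycle : ∀ k (c : Fin (suc (suc (suc k))) → Node) → IsCycle PendantTree k c →
                      (∀ j → rank (c j) ≤ 0) → ⊥
    base-only-cycle k c cycle rank≤0 =
      acyclic (k , _ , base-cycle k c (λ j → proj₁ (baseNode (c j) (rank≤0 j)))
                                     (λ j → proj₂ (baseNode (c j) (rank≤0 j))) cycle)
      where
      baseNode : ∀ x → rank x ≤ 0 → ∃ λ a → x ≡ inj₁ a
      baseNode (inj₁ a) _ = a , refl

    -- Both cycle neighbours of a pendant node of maximal rank would be its parent.
    pendant-not-top : ∀ k (c : Fin (suc (suc (suc k))) → Node) → IsCycle PendantTree k c →
      ∀ top {p i} → c top ≡ inj₂ (p , i) → (∀ j → rank (c j) ≤ suc (toℕ i)) → ⊥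
    pendant-not-top k c cycle@(c-inj , _) top {p} {i} top≡ below
      with cycle-neighbours {R = PendantTree} pendant-sym k c cycle top
    ... | y , y′ , y≢y′ , r , r′ = y≢y′ (c-inj (trans (toParent y r) (sym (toParent y′ r′))))
      where
      toParent : ∀ z → PendantTree (c top) (c z) → c z ≡ parent p i
      toParent z edge = lower-neighbour (subst (λ x → PendantTree x (c z)) top≡ edge) (below z)

    top-rank-node : ∀ k (c : Fin (suc (suc (suc k))) → Node) → IsCycle PendantTree k c →
                    ∀ top → (∀ j → rank (c j) ≤ rank (c top)) → ⊥
    top-rank-node k c cycle top below with c top in top≡
    ... | inj₁ _ = base-only-cycle k c cycle below
    ... | inj₂ _ = pendant-not-top k c cycle top top≡ below

    pendant-acyclic : ¬ Cycle PendantTree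
    pendant-acyclic (k , c , cycle) = uncurry (top-rank-node k c cycle) (maximum (rank ∘ c))

    toPoint : ∀ x → WalkIn PendantTree Everywhere x (inj₁ point)
    toPoint (inj₁ s) = mapʷ inj₁ (inj₁ ∘ base) _ (connected s point)
    toPoint (inj₂ (p , i)) = descend Everywhere tt (λ _ → tt) i ++ʷ toPoint (inj₁ (root p))

    pendant-isTree : IsTreeOn Node PendantTree
    pendant-isTree = record
      { point = inj₁ point
      ; symmetric = pendant-sym
      ; irreflexive = λ
          { (inj₁ (base r)) → irreflexive r
          ; (inj₂ (base r)) → irreflexive r
          ; (inj₁ (next _ _ _ eq)) → ℕ.1+n≢n eq
          ; (inj₂ (next _ _ _ eq)) → ℕ.1+n≢n eq }
      ; connected = λ x y → toPoint x ++ʷ reverseʷ pendant-sym (toPoint y)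
      ; acyclic = pendant-acyclic }

module Distension {n : ℕ} (G : FinGraph n) (len : Edge G → ℕ) where

  Pair : Set
  Pair = Fin n × Fin n

  ends : Edge G → Pair
  ends e = proj₁ e , proj₁ (proj₂ e)

  IsEnd : Edge G → Fin n → Set
  IsEnd e w = w ≡ proj₁ e ⊎ w ≡ proj₁ (proj₂ e)

  adjacent : ∀ e → Adj G (proj₁ (ends e)) (proj₂ (ends e))
  adjacent (a , b , ab) = proj₁ (Equivalence.to T-∧ ab)

  -- Pendant paths are indexed by all pairs of vertices; pairs that are not edges get empty bags.
  edgeAt : Pair → Maybe (Edge G)
  edgeAt (a , b) with T? (adj G a b ∧ (toℕ a <ᵇ toℕ b))
  ... | yes ab = just (a , b , ab)
  ... | no _ = nothing

  edgeAt-ends : ∀ e → edgeAt (ends e) ≡ just e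
  edgeAt-ends (a , b , ab) with T? (adj G a b ∧ (toℕ a <ᵇ toℕ b))
  ... | yes ab′ = cong (λ ab → just (a , b , ab)) (T-irrelevant ab′ ab)
  ... | no ¬ab = ⊥-elim (¬ab ab)

  ends-edgeAt : ∀ {p e} → edgeAt p ≡ just e → ends e ≡ p
  ends-edgeAt {a , b} eq with T? (adj G a b ∧ (toℕ a <ᵇ toℕ b))
  ends-edgeAt refl | yes _ = refl

  module _ {X : Set} (f : Edge G → List X) where

    atPair : Pair → List X
    atPair p = maybe′ f [] (edgeAt p)

    ∈-atPair⁺ : ∀ {x} e → x ∈ f e → x ∈ atPair (ends e)
    ∈-atPair⁺ e x∈ rewrite edgeAt-ends e = x∈

    ∈-atPair⁻ : ∀ {x p} → x ∈ atPair p → ∃ λ e → ends e ≡ p × x ∈ f e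
    ∈-atPair⁻ {p = p} x∈ with edgeAt p in eq
    ... | just e = e , ends-edgeAt eq , x∈

    atPair-length : ∀ {b} → (∀ e → length (f e) ≤ b) → ∀ p → length (atPair p) ≤ b
    atPair-length f≤b p with edgeAt p
    ... | just e = f≤b e
    ... | nothing = z≤n

  -- All paths are shorter than longest, so one index set Fin (suc longest) serves them all.
  longest : ℕ
  longest = max 0 (map (λ p → maybe′ len 0 (edgeAt p)) (cartesianProduct (allFin n) (allFin n)))

  len≤longest : ∀ e → len e ≤ longest
  len≤longest e@(a , b , _) = subst (_≤ longest) (cong (maybe′ len 0) (edgeAt-ends e))
    (All.lookup (xs≤max 0 _) (∈-map⁺ _ (∈-cartesianProduct⁺ (∈-allFin a) (∈-allFin b))))

  lift : ∀ e → Fin (suc (len e)) → Fin (suc longest)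
  lift e j = inject≤ j (s≤s (len≤longest e))

  toℕ-lift : ∀ e j → toℕ (lift e j) ≡ toℕ j
  toℕ-lift e j = Fin.toℕ-inject≤ j _

  Vertex : Set
  Vertex = DistVertex G len

  pathBag : Edge G → ℕ → List Vertex
  pathBag e k = map (λ j → inj₂ (e , j)) (window (len e) k)

  ∈-pathBag⁺ : ∀ e j {k} → Covers k (toℕ j) → inj₂ (e , j) ∈ pathBag e k
  ∈-pathBag⁺ e j cov = ∈-map⁺ _ (∈-window⁺ j cov)

  ∈-pathBag⁻ : ∀ e k {e′ j} → inj₂ (e′ , j) ∈ pathBag e k → e ≡ e′ × Covers k (toℕ j)
  ∈-pathBag⁻ e k x∈ with ∈-map⁻ (λ j → inj₂ (e , j)) x∈
  ... | _ , j∈ , refl = refl , ∈-window⁻ j∈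

  inj₁∉pathBag : ∀ e k {w} → ¬ inj₁ w ∈ pathBag e k
  inj₁∉pathBag e k x∈ with ∈-map⁻ (λ j → inj₂ (e , j)) x∈
  ... | _ , _ , ()

  pathBag-length : ∀ e k → length (pathBag e k) ≤ 2
  pathBag-length e k = subst (_≤ 2) (sym (length-map _ (window (len e) k))) (window-length (len e) k)

  module Anchor {m : ℕ} (B : Fin m → List (Fin n))
                (cover-v : ∀ v → ∃ λ t → v ∈ B t)
                (cover-e : ∀ u v → Adj G u v → ∃ λ t → (u ∈ B t) × (v ∈ B t)) where

    -- cover-v only supplies a junk value for pairs that are not edges.
    anchor : Pair → Fin m
    anchor p = maybe′ (λ e → proj₁ (cover-e _ _ (adjacent e))) (proj₁ (cover-v (proj₁ p))) (edgeAt p)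

    end∈anchor : ∀ e {w} → IsEnd e w → w ∈ B (anchor (ends e))
    end∈anchor e@(a , b , _) w-end rewrite edgeAt-ends e with w-end
    ... | inj₁ refl = proj₁ (proj₂ (cover-e a b (adjacent e)))
    ... | inj₂ refl = proj₂ (proj₂ (cover-e a b (adjacent e)))

  chain↔ : Fin (n * n * suc longest) ↔ (Pair × Fin (suc longest))
  chain↔ = ↔-trans Fin.*↔× (×-cong Fin.*↔× ↔-refl)

  module Treewidth {k : ℕ} (D : TreeDecomp (Adj G) k) where
    open TreeDecomp D renaming (bag to B)
    open Anchor B cover-v cover-e
    open Pendant tree anchor longest

    edgeBag : Edge G → ℕ → List Vertex
    edgeBag e i = inj₁ (proj₁ e) ∷ inj₁ (proj₁ (proj₂ e)) ∷ pathBag e i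

    ∈-edgeBag-end⁺ : ∀ e i {w} → IsEnd e w → inj₁ w ∈ edgeBag e i
    ∈-edgeBag-end⁺ e i (inj₁ refl) = here refl
    ∈-edgeBag-end⁺ e i (inj₂ refl) = there (here refl)

    ∈-edgeBag-end⁻ : ∀ e i {w} → inj₁ w ∈ edgeBag e i → IsEnd e w
    ∈-edgeBag-end⁻ e i (here refl) = inj₁ refl
    ∈-edgeBag-end⁻ e i (there (here refl)) = inj₂ refl
    ∈-edgeBag-end⁻ e i (there (there w∈)) = ⊥-elim (inj₁∉pathBag e i w∈)

    ∈-edgeBag-path⁻ : ∀ e i {e′ j} → inj₂ (e′ , j) ∈ edgeBag e i → e ≡ e′ × Covers i (toℕ j)
    ∈-edgeBag-path⁻ e i (there (there x∈)) = ∈-pathBag⁻ e i x∈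

    chainBag : Fin (suc longest) → Edge G → List Vertex
    chainBag i e = edgeBag e (toℕ i)

    bag : Node → List Vertex
    bag (inj₁ t) = map inj₁ (B t)
    bag (inj₂ (p , i)) = atPair (chainBag i) p

    ∈-chain : ∀ e i {x} → x ∈ edgeBag e (toℕ i) → x ∈ bag (inj₂ (ends e , i))
    ∈-chain e i = ∈-atPair⁺ (chainBag i) e

    path∈chain : ∀ e i j → Covers (toℕ i) (toℕ j) → inj₂ (e , j) ∈ bag (inj₂ (ends e , i))
    path∈chain e i j cov = ∈-chain e i (there (there (∈-pathBag⁺ e j cov)))

    inj₂∉base : ∀ {t x} → ¬ inj₂ x ∈ bag (inj₁ t)
    inj₂∉base {t} x∈ with ∈-map⁻ inj₁ x∈
    ... | _ , _ , ()

    bag-width : ∀ x → length (bag x) ≤ suc (k ⊔ 3)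
    bag-width (inj₁ t) = subst (_≤ suc (k ⊔ 3)) (sym (length-map inj₁ (B t)))
                               (ℕ.≤-trans (width t) (s≤s (ℕ.m≤m⊔n k 3)))
    bag-width (inj₂ (p , i)) =
      ℕ.≤-trans (atPair-length (chainBag i) (λ e → s≤s (s≤s (pathBag-length e (toℕ i)))) p)
                (s≤s (ℕ.m≤n⊔m k 3))

    cover-vertex : ∀ v → ∃ λ x → v ∈ bag x
    cover-vertex (inj₁ w) = let (t , w∈) = cover-v w in inj₁ t , ∈-map⁺ inj₁ w∈
    cover-vertex (inj₂ (e , j)) = inj₂ (ends e , lift e j) , path∈chain e (lift e j) j (inj₁ (toℕ-lift e j))

    cover-link : ∀ {u v} → DistAdj₀ G len u v → ∃ λ x → (u ∈ bag x) × (v ∈ bag x)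
    cover-link (old {a} {b} ab) =
      let (t , a∈ , b∈) = cover-e a b ab in inj₁ t , ∈-map⁺ inj₁ a∈ , ∈-map⁺ inj₁ b∈
    cover-link (endˡ e i) =
      inj₂ (ends e , lift e i) , ∈-chain e (lift e i) (here refl) ,
      path∈chain e (lift e i) i (inj₁ (toℕ-lift e i))
    cover-link (endʳ e i) =
      inj₂ (ends e , lift e i) , ∈-chain e (lift e i) (there (here refl)) ,
      path∈chain e (lift e i) i (inj₁ (toℕ-lift e i))
    cover-link (along e i j i→j) =
      inj₂ (ends e , lift e j) , path∈chain e (lift e j) i (inj₂ (trans (toℕ-lift e j) i→j)) ,
      path∈chain e (lift e j) j (inj₁ (toℕ-lift e j))

    toBase : ∀ w x → inj₁ w ∈ bag x →
      ∃ λ t → w ∈ B t × WalkIn PendantTree (λ s → inj₁ w ∈ bag s) x (inj₁ t)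
    toBase w (inj₁ t) w∈ with ∈-map⁻ inj₁ w∈
    ... | _ , w∈t , refl = t , w∈t , stop w∈
    toBase w (inj₂ (p , i)) w∈ with ∈-atPair⁻ (chainBag i) w∈
    ... | e , refl , w∈e = anchor (ends e) , end∈anchor e end ,
      descend (λ s → inj₁ w ∈ bag s) (∈-map⁺ inj₁ (end∈anchor e end))
              (λ i′ → ∈-chain e i′ (∈-edgeBag-end⁺ e (toℕ i′) end)) i
      where
      end : IsEnd e w
      end = ∈-edgeBag-end⁻ e (toℕ i) w∈e

    bags-connected : ∀ v x y → v ∈ bag x → v ∈ bag y → WalkIn PendantTree (λ s → v ∈ bag s) x y
    bags-connected (inj₁ w) x y w∈x w∈y with toBase w x w∈x | toBase w y w∈y
    ... | t , w∈t , x→t | t′ , w∈t′ , y→t′ =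
      x→t ++ʷ (mapʷ inj₁ (inj₁ ∘ base) (∈-map⁺ inj₁) (subtree w t t′ w∈t w∈t′)
           ++ʷ reverseʷ pendant-sym y→t′)
    bags-connected (inj₂ _) (inj₁ _) _ v∈ _ = ⊥-elim (inj₂∉base v∈)
    bags-connected (inj₂ _) (inj₂ _) (inj₁ _) _ v∈ = ⊥-elim (inj₂∉base v∈)
    bags-connected (inj₂ (e , j)) (inj₂ (p , i)) (inj₂ (p′ , i′)) v∈ v∈′
      with ∈-atPair⁻ (chainBag i) v∈ | ∈-atPair⁻ (chainBag i′) v∈′
    ... | e₁ , refl , v∈₁ | e₂ , refl , v∈₂
      with ∈-edgeBag-path⁻ e₁ (toℕ i) v∈₁ | ∈-edgeBag-path⁻ e₂ (toℕ i′) v∈₂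
    ... | refl , cov | refl , cov′ = coveringʷ (λ s → inj₂ (e , j) ∈ bag s) i i′ cov cov′ v∈ v∈′

    decomposition : TreeDecompOn (DistAdj G len) (k ⊔ 3) Node
    decomposition = record
      { tree = PendantTree
      ; isTree = pendant-isTree (IsTree⇒IsTreeOn isTree)
      ; bag = bag
      ; width = bag-width
      ; cover-v = cover-vertex
      ; cover-e = covers-sym bag cover-link
      ; subtree = bags-connected }

    nodes↔ : Fin (m + n * n * suc longest) ↔ Node
    nodes↔ = ↔-trans Fin.+↔⊎ (⊎-cong ↔-refl chain↔)

  module Pathwidth {k : ℕ} (D : PathDecomp (Adj G) k) where
    open PathDecomp D renaming (bag to B)
    open Anchor B cover-v cover-e

    Node : Set
    Node = Fin m × (⊤ ⊎ Pair × Fin (suc longest))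

    chainPaths : Fin (suc longest) → Edge G → List Vertex
    chainPaths i e = pathBag e (toℕ i)

    -- The pendant path of pair p is spread over the copies of the bag anchor p.
    hanging : Fin m → ⊤ ⊎ Pair × Fin (suc longest) → List Vertex
    hanging t (inj₁ _) = []
    hanging t (inj₂ (p , i)) with anchor p Fin.≟ t
    ... | yes _ = atPair (chainPaths i) p
    ... | no _ = []

    ∈-hanging⁺ : ∀ e i j → Covers (toℕ i) (toℕ j) →
                 inj₂ (e , j) ∈ hanging (anchor (ends e)) (inj₂ (ends e , i))
    ∈-hanging⁺ e i j cov with anchor (ends e) Fin.≟ anchor (ends e)
    ... | yes _ = ∈-atPair⁺ (chainPaths i) e (∈-pathBag⁺ e j cov)
    ... | no ≢ = ⊥-elim (≢ refl)

    ∈-hanging⁻ : ∀ t r {e j} → inj₂ (e , j) ∈ hanging t r →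
      ∃ λ i → r ≡ inj₂ (ends e , i) × anchor (ends e) ≡ t × Covers (toℕ i) (toℕ j)
    ∈-hanging⁻ t (inj₂ (p , i)) x∈ with anchor p Fin.≟ t
    ... | yes anchored with ∈-atPair⁻ (chainPaths i) x∈
    ...   | e′ , refl , x∈′ with ∈-pathBag⁻ e′ (toℕ i) x∈′
    ...     | refl , cov = i , refl , anchored , cov

    inj₁∉hanging : ∀ t r {w} → ¬ inj₁ w ∈ hanging t r
    inj₁∉hanging t (inj₂ (p , i)) w∈ with anchor p Fin.≟ t
    ... | yes _ with ∈-atPair⁻ (chainPaths i) w∈
    ...   | e , _ , w∈′ = inj₁∉pathBag e (toℕ i) w∈′

    hanging-length : ∀ t r → length (hanging t r) ≤ 2
    hanging-length t (inj₁ _) = z≤n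
    hanging-length t (inj₂ (p , i)) with anchor p Fin.≟ t
    ... | yes _ = atPair-length (chainPaths i) (λ e → pathBag-length e (toℕ i)) p
    ... | no _ = z≤n

    bag : Node → List Vertex
    bag (t , r) = map inj₁ (B t) ++ hanging t r

    ∈-bag-base⁺ : ∀ {w t} r → w ∈ B t → inj₁ w ∈ bag (t , r)
    ∈-bag-base⁺ r w∈ = ∈-++⁺ˡ (∈-map⁺ inj₁ w∈)

    ∈-bag-base⁻ : ∀ {w} t r → inj₁ w ∈ bag (t , r) → w ∈ B t
    ∈-bag-base⁻ t r w∈ with ∈-++⁻ (map inj₁ (B t)) w∈
    ... | inj₂ w∈′ = ⊥-elim (inj₁∉hanging t r w∈′)
    ... | inj₁ w∈′ with ∈-map⁻ inj₁ w∈′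
    ...   | _ , w∈t , refl = w∈t

    ∈-bag-path⁻ : ∀ t r {e j} → inj₂ (e , j) ∈ bag (t , r) →
      ∃ λ i → r ≡ inj₂ (ends e , i) × anchor (ends e) ≡ t × Covers (toℕ i) (toℕ j)
    ∈-bag-path⁻ t r x∈ with ∈-++⁻ (map inj₁ (B t)) x∈
    ... | inj₂ x∈′ = ∈-hanging⁻ t r x∈′
    ... | inj₁ x∈′ with ∈-map⁻ inj₁ x∈′
    ...   | _ , _ , ()

    path∈chain : ∀ e i j → Covers (toℕ i) (toℕ j) →
                 inj₂ (e , j) ∈ bag (anchor (ends e) , inj₂ (ends e , i))
    path∈chain e i j cov = ∈-++⁺ʳ _ (∈-hanging⁺ e i j cov)

    bag-width : ∀ x → length (bag x) ≤ suc (k + 2)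
    bag-width (t , r) = subst (_≤ suc (k + 2)) (sym (length-++ (map inj₁ (B t))))
      (ℕ.+-mono-≤ (subst (_≤ suc k) (sym (length-map inj₁ (B t))) (width t)) (hanging-length t r))

    cover-vertex : ∀ v → ∃ λ x → v ∈ bag x
    cover-vertex (inj₁ w) = let (t , w∈) = cover-v w in (t , inj₁ tt) , ∈-bag-base⁺ (inj₁ tt) w∈
    cover-vertex (inj₂ (e , j)) = _ , path∈chain e (lift e j) j (inj₁ (toℕ-lift e j))

    cover-link : ∀ {u v} → DistAdj₀ G len u v → ∃ λ x → (u ∈ bag x) × (v ∈ bag x)
    cover-link (old {a} {b} ab) =
      let (t , a∈ , b∈) = cover-e a b ab
      in (t , inj₁ tt) , ∈-bag-base⁺ (inj₁ tt) a∈ , ∈-bag-base⁺ (inj₁ tt) b∈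
    cover-link (endˡ e i) =
      _ , ∈-bag-base⁺ (inj₂ (ends e , lift e i)) (end∈anchor e (inj₁ refl)) ,
      path∈chain e (lift e i) i (inj₁ (toℕ-lift e i))
    cover-link (endʳ e i) =
      _ , ∈-bag-base⁺ (inj₂ (ends e , lift e i)) (end∈anchor e (inj₂ refl)) ,
      path∈chain e (lift e i) i (inj₁ (toℕ-lift e i))
    cover-link (along e i j i→j) =
      _ , path∈chain e (lift e j) i (inj₂ (trans (toℕ-lift e j) i→j)) ,
      path∈chain e (lift e j) j (inj₁ (toℕ-lift e j))

    -- Lexicographic order: bag t first, then its copies indexed by pair and path position.
    nodes↔ : Fin (m * suc (n * n * suc longest)) ↔ Node
    nodes↔ = ↔-trans Fin.*↔× (×-cong ↔-refl (↔-trans Fin.+↔⊎ (⊎-cong Fin.1↔⊤ chain↔)))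

    open Inverse nodes↔ using (from)
    open Reindex nodes↔ using (from-injective)

    position : Node → ℕ
    position x = toℕ (from x)

    position-base : ∀ {t t′} r r′ → position (t , r) ≤ position (t′ , r′) → toℕ t ≤ toℕ t′
    position-base r r′ x≤y = ℕ.≮⇒≥ (λ t′<t → ℕ.<⇒≱ (Fin.combine-monoˡ-< _ _ t′<t) x≤y)

    chainStart : Fin m → Pair → ℕ
    chainStart t (a , b) = suc (n * n * suc longest) * toℕ t + suc (suc longest * toℕ (combine a b))

    position-chain : ∀ t p i → position (t , inj₂ (p , i)) ≡ chainStart t p + toℕ i
    position-chain t (a , b) i = begin
      toℕ (combine t (fsuc (combine (combine a b) i)))
        ≡⟨ Fin.toℕ-combine t _ ⟩
      C * toℕ t + suc (toℕ (combine (combine a b) i))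
        ≡⟨ cong (λ z → C * toℕ t + suc z) (Fin.toℕ-combine (combine a b) i) ⟩
      C * toℕ t + suc (suc longest * toℕ (combine a b) + toℕ i)
        ≡⟨ sym (ℕ.+-assoc (C * toℕ t) _ (toℕ i)) ⟩
      chainStart t (a , b) + toℕ i ∎
      where
      open ≡-Reasoning
      C : ℕ
      C = suc (n * n * suc longest)

    position-covers : ∀ t p i i′ {j} → Covers (toℕ i) j → Covers (toℕ i′) j →
                      position (t , inj₂ (p , i′)) ≤ suc (position (t , inj₂ (p , i)))
    position-covers t p i i′ cov cov′ = begin
      position (t , inj₂ (p , i′))  ≡⟨ position-chain t p i′ ⟩
      chainStart t p + toℕ i′       ≤⟨ ℕ.+-monoʳ-≤ (chainStart t p) (covers-close cov cov′) ⟩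
      chainStart t p + suc (toℕ i)  ≡⟨ ℕ.+-suc (chainStart t p) (toℕ i) ⟩
      suc (chainStart t p + toℕ i)  ≡⟨ cong suc (sym (position-chain t p i)) ⟩
      suc (position (t , inj₂ (p , i))) ∎
      where open ℕ.≤-Reasoning

    -- An old vertex inherits its interval through the first coordinate; a path vertex lies
    -- in at most two bags, and these are consecutive.
    bag-interval : ∀ v x y z → position x ≤ position y → position y ≤ position z →
                   v ∈ bag x → v ∈ bag z → v ∈ bag y
    bag-interval (inj₁ w) (t , r) (t′ , r′) (t″ , r″) x≤y y≤z w∈x w∈z =
      ∈-bag-base⁺ r′ (interval w t t′ t″ (position-base r r′ x≤y) (position-base r′ r″ y≤z)
                                          (∈-bag-base⁻ t r w∈x) (∈-bag-base⁻ t″ r″ w∈z))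
    bag-interval v@(inj₂ (e , j)) (t , r) y (t″ , r″) x≤y y≤z v∈x v∈z
      with ∈-bag-path⁻ t r v∈x | ∈-bag-path⁻ t″ r″ v∈z
    ... | i , refl , refl , cov | i″ , refl , refl , cov″
      with between-consecutive x≤y y≤z (position-covers (anchor (ends e)) (ends e) i i″ cov cov″)
    ... | inj₁ y≡x =
      subst (λ s → v ∈ bag s) (from-injective {x = (t , r)} {y = y} (Fin.toℕ-injective (sym y≡x))) v∈x
    ... | inj₂ y≡z =
      subst (λ s → v ∈ bag s) (from-injective {x = (t″ , r″)} {y = y} (Fin.toℕ-injective (sym y≡z))) v∈z

    decomposition : PathDecompOn (DistAdj G len) (k + 2) nodes↔
    decomposition = record
      { bag = bag
      ; width = bag-width
      ; cover-v = cover-vertex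
      ; cover-e = covers-sym bag cover-link
      ; interval = bag-interval }

lemma14 : ∀ {n} (G : FinGraph n) (len : Edge G → ℕ) →
    (∀ k → TreeDecomp (Adj G) k → TreeDecomp (DistAdj G len) (k ⊔ 3)) ×
    (∀ k → PathDecomp (Adj G) k → PathDecomp (DistAdj G len) (k + 2))
lemma14 G len =
  (λ k D → TreeDecompOn.toTreeDecomp (Treewidth.decomposition D) (Treewidth.nodes↔ D)) ,
  (λ k D → PathDecompOn.toPathDecomp (Pathwidth.decomposition D))
  where open Distension G len
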